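{- For $\Gamma$ a finite sequent of classical propositional logic, if $\mathtt{CL}$ derives $\vdash\Gamma$ then $\mathtt{ALV}$ derives $\vdash\exists x\Gamma^*$. Thus classical propositional logic is a subsystem of affine propositional logic extended with infinitary rules for vacuous quantification.
   Context: $\mathtt{CL}$ is Tait-style classical propositional logic: initial sequents $\vdash\Gamma,P,\overline{P}$; from $\vdash\Gamma,A$ and $\vdash\Gamma,B$ infer $\vdash\Gamma,A\wedge B$; from $\vdash\Gamma,A,B$ infer $\vdash\Gamma,A\vee B$. $\mathtt{AL}$ is affine logic: one-sided sequent calculus with initial sequents $\vdash\Gamma,P,\overline{P}$ and rules for $\oplus$, $\&$ (additive conjunction), $⅋$ (multiplicative disjunction: from $\vdash\Gamma,A,B$ infer $\vdash\Gamma,A⅋B$), $\otimes$ (from $\vdash\Gamma,A$, $\vdash\Delta,B$ infer $\vdash\Gamma,\Delta,A\otimes B$), $\forall,\exists$, no contraction. $\mathtt{ALV}$ extends $\mathtt{AL}$ (allowing infinite multisets) with rules for vacuous quantification: from $\vdash\Gamma,A^\infty$ infer $\vdash\Gamma,\exists xA$, and from premises $\vdash\Gamma_i,A$ ($i\in\mathbb{N}$) infer $\vdash\biguplus_i\Gamma_i,\forall xA$, where $A^\infty$ is the multiset of infinitely many copies of $A$ and $x$ is not free in $A$. Translation: $P^*=P$, $\overline{P}^*=\overline{P}$, $(A\vee B)^*=\exists xA^*⅋\exists yB^*$, $(A\wedge B)^*=\exists xA^*\otimes\exists yB^*$ (vacuous quantifiers); $\exists x\Gamma^*$ is obtained by prefixing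 each formula of $\Gamma^*$ with a vacuous $\exists x$. -}

module Defs where

open import Data.Nat using (ℕ)
open import Data.Fin using (Fin)
open import Data.List using (List; []; _∷_; length; lookup)
open import Data.List.Relation.Binary.Permutation.Propositional using (_↭_)
open import Data.Sum using (_⊎_; inj₁; inj₂; [_,_])
open import Data.Unit using (⊤; tt)
open import Data.Product using (Σ; _,_; proj₁; proj₂)
open import Function using (_∘_; const)
open import Function.Bundles using (_↔_; Inverse)
open import Relation.Binary.PropositionalEquality using (_≡_)

Atom : Set
Atom = ℕ

data CFml : Set where
  pos : Atom → CFml
  neg : Atom → CFml
  _∧_ : CFml → CFml → CFml
  _∨_ : CFml → CFml → CFml

-- Finite sequents: lists of formulas, read as multisets (exchange rule).
data CL⊢_ : List CFml → Set where
  cl-ax   : ∀ Γ P → CL⊢ (pos P ∷ neg P ∷ Γ)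
  cl-∧    : ∀ {Γ A B} → CL⊢ (A ∷ Γ) → CL⊢ (B ∷ Γ) → CL⊢ ((A ∧ B) ∷ Γ)
  cl-∨    : ∀ {Γ A B} → CL⊢ (A ∷ B ∷ Γ) → CL⊢ ((A ∨ B) ∷ Γ)
  cl-exch : ∀ {Γ Δ} → Γ ↭ Δ → CL⊢ Γ → CL⊢ Δ

-- In the propositional language no variable occurs free in any formula,
-- so every quantifier is vacuous and variable names are irrelevant.

data AFml : Set where
  pos  : Atom → AFml
  neg  : Atom → AFml
  _⊕_  : AFml → AFml → AFml
  _&_  : AFml → AFml → AFml
  _⅋_  : AFml → AFml → AFml
  _⊗_  : AFml → AFml → AFml
  ∀′   : AFml → AFml
  ∃′   : AFml → AFml

-- Possibly infinite multisets of formulas: an index set with a labelling.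
record Seq : Set₁ where
  constructor ⟨_,_⟩
  field
    Idx : Set
    fm  : Idx → AFml
open Seq public

infixl 5 _,,_
infixl 6 _⊎ˢ_
_,,_ : Seq → AFml → Seq
Γ ,, A = ⟨ Idx Γ ⊎ ⊤ , [ fm Γ , const A ] ⟩

_⊎ˢ_ : Seq → Seq → Seq
Γ ⊎ˢ Δ = ⟨ Idx Γ ⊎ Idx Δ , [ fm Γ , fm Δ ] ⟩

_^∞ : AFml → Seq
A ^∞ = ⟨ ℕ , const A ⟩

⨄ : (ℕ → Seq) → Seq
⨄ Γs = ⟨ Σ ℕ (λ i → Idx (Γs i)) , (λ p → fm (Γs (proj₁ p)) (proj₂ p)) ⟩

_≈ˢ_ : Seq → Seq → Set
Γ ≈ˢ Δ = Σ (Idx Γ ↔ Idx Δ) (λ e → ∀ i → fm Δ (Inverse.to e i) ≡ fm Γ i)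

data ALV⊢_ : Seq → Set₁ where
  ax    : ∀ Γ P → ALV⊢ (Γ ,, pos P ,, neg P)
  ⊕₁    : ∀ {Γ A B} → ALV⊢ (Γ ,, A) → ALV⊢ (Γ ,, (A ⊕ B))
  ⊕₂    : ∀ {Γ A B} → ALV⊢ (Γ ,, B) → ALV⊢ (Γ ,, (A ⊕ B))
  &-r   : ∀ {Γ A B} → ALV⊢ (Γ ,, A) → ALV⊢ (Γ ,, B) → ALV⊢ (Γ ,, (A & B))
  ⅋-r   : ∀ {Γ A B} → ALV⊢ (Γ ,, A ,, B) → ALV⊢ (Γ ,, (A ⅋ B))
  ⊗-r   : ∀ {Γ Δ A B} → ALV⊢ (Γ ,, A) → ALV⊢ (Δ ,, B) → ALV⊢ ((Γ ⊎ˢ Δ) ,, (A ⊗ B))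
  ∀-r   : ∀ {Γ A} → ALV⊢ (Γ ,, A) → ALV⊢ (Γ ,, ∀′ A)
  ∃-r   : ∀ {Γ A} → ALV⊢ (Γ ,, A) → ALV⊢ (Γ ,, ∃′ A)
  ∃∞    : ∀ {Γ A} → ALV⊢ (Γ ⊎ˢ (A ^∞)) → ALV⊢ (Γ ,, ∃′ A)
  ∀∞    : ∀ {A} (Γs : ℕ → Seq) → (∀ i → ALV⊢ (Γs i ,, A)) → ALV⊢ (⨄ Γs ,, ∀′ A)
  exch  : ∀ {Γ Δ} → Γ ≈ˢ Δ → ALV⊢ Γ → ALV⊢ Δ

_* : CFml → AFml
pos P * = pos P
neg P * = neg P
(A ∨ B) * = ∃′ (A *) ⅋ ∃′ (B *)
(A ∧ B) * = ∃′ (A *) ⊗ ∃′ (B *)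

∃Γ* : List CFml → Seq
∃Γ* Γ = ⟨ Fin (length Γ) , (λ i → ∃′ (lookup Γ i *)) ⟩

-- Replace every formula C of a classical sequent by infinitely many copies of C*.
-- Such a sequent ∞Γ* Δ absorbs further copies of its members and is isomorphic to two
-- copies of itself, so the shared context of CL's ∧-rule can be split by ⊗ at no cost,
-- and a CL derivation of Γ becomes an ALV derivation of ∞Γ* Δ for every Δ ⊇ Γ.  The
-- infinitary rule ∃∞ then collapses each block (C *) ^∞ into the single formula ∃x C*.

module Submission where

open import Algebra.Bundles using (CommutativeSemigroup)
open import Algebra.Structures using (IsCommutativeSemigroup)
open import Data.Empty using (⊥)
open import Data.Fin using (zero; suc)
open import Data.Fin.Properties using (0↔⊥)
open import Data.List using (List; []; _∷_)
open import Data.List.Membership.Propositional using (_∈_)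
open import Data.List.Relation.Binary.Subset.Propositional using (_⊆_)
open import Data.List.Relation.Binary.Subset.Propositional.Properties
  using (⊆-refl; ⊆-trans; ⊆-reflexive-↭; xs⊆x∷xs; ∷⁺ʳ)
open import Data.List.Relation.Unary.Any using (here; there)
open import Data.Nat using (ℕ; zero; suc; _+_)
open import Data.Product using (_,_)
open import Data.Sum using (_⊎_; inj₁; inj₂; [_,_]; map)
open import Data.Sum.Algebra using (⊎-cong; ⊎-assoc; ⊎-comm)
open import Data.Unit using (⊤; tt)
open import Function using (_∘_; id; const)
open import Function.Bundles using (_↔_; Inverse; mk↔ₛ′)
open import Function.Properties.Inverse using (↔-refl; ↔-sym; ↔-trans)
open import Level using (0ℓ) renaming (suc to lsuc)
open import Relation.Binary.PropositionalEquality using (_≡_; refl; sym; trans; cong)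

open import Defs

∅ : Seq
∅ = ⟨ ⊥ , (λ ()) ⟩

single : AFml → Seq
single A = ⟨ ⊤ , const A ⟩

≈ˢ-refl : ∀ {Γ} → Γ ≈ˢ Γ
≈ˢ-refl = ↔-refl , λ _ → refl

≈ˢ-sym : ∀ {Γ Δ} → Γ ≈ˢ Δ → Δ ≈ˢ Γ
≈ˢ-sym {Γ} {Δ} (e , e-fm) =
  ↔-sym e , λ j → trans (sym (e-fm (from j))) (cong (fm Δ) (strictlyInverseˡ j))
  where open Inverse e

≈ˢ-trans : ∀ {Γ Δ Θ} → Γ ≈ˢ Δ → Δ ≈ˢ Θ → Γ ≈ˢ Θ
≈ˢ-trans (e , e-fm) (f , f-fm) = ↔-trans e f , λ i → trans (f-fm (Inverse.to e i)) (e-fm i)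

⊎ˢ-cong : ∀ {Γ Γ′ Δ Δ′} → Γ ≈ˢ Γ′ → Δ ≈ˢ Δ′ → (Γ ⊎ˢ Δ) ≈ˢ (Γ′ ⊎ˢ Δ′)
⊎ˢ-cong (e , e-fm) (f , f-fm) = ⊎-cong e f , λ { (inj₁ i) → e-fm i ; (inj₂ j) → f-fm j }

⊎ˢ-assoc : ∀ Γ Δ Θ → ((Γ ⊎ˢ Δ) ⊎ˢ Θ) ≈ˢ (Γ ⊎ˢ (Δ ⊎ˢ Θ))
⊎ˢ-assoc _ _ _ = ⊎-assoc 0ℓ _ _ _ , λ
  { (inj₁ (inj₁ _)) → refl ; (inj₁ (inj₂ _)) → refl ; (inj₂ _) → refl }

⊎ˢ-comm : ∀ Γ Δ → (Γ ⊎ˢ Δ) ≈ˢ (Δ ⊎ˢ Γ)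
⊎ˢ-comm _ _ = ⊎-comm _ _ , λ { (inj₁ _) → refl ; (inj₂ _) → refl }

⊎ˢ-identityˡ : ∀ Γ → (∅ ⊎ˢ Γ) ≈ˢ Γ
⊎ˢ-identityˡ _ =
  mk↔ₛ′ [ (λ ()) , id ] inj₂ (λ _ → refl) (λ { (inj₁ ()) ; (inj₂ _) → refl })
  , λ { (inj₂ _) → refl }

⊎ˢ-isCommutativeSemigroup : IsCommutativeSemigroup _≈ˢ_ _⊎ˢ_
⊎ˢ-isCommutativeSemigroup = record
  { isSemigroup = record
    { isMagma = record
      { isEquivalence = record
        { refl  = λ {Γ} → ≈ˢ-refl {Γ}
        ; sym   = ≈ˢ-sym
        ; trans = λ {Γ Δ Θ} → ≈ˢ-trans {Γ} {Δ} {Θ}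
        }
      ; ∙-cong = ⊎ˢ-cong
      }
    ; assoc = ⊎ˢ-assoc
    }
  ; comm = ⊎ˢ-comm
  }

⊎ˢ-commutativeSemigroup : CommutativeSemigroup (lsuc 0ℓ) 0ℓ
⊎ˢ-commutativeSemigroup = record { isCommutativeSemigroup = ⊎ˢ-isCommutativeSemigroup }

open import Algebra.Properties.CommutativeSemigroup ⊎ˢ-commutativeSemigroup
  using (interchange; x∙yz≈y∙xz; xy∙z≈xz∙y)
open import Relation.Binary.Reasoning.Setoid (CommutativeSemigroup.setoid ⊎ˢ-commutativeSemigroup)

ℕ⊎⊤↔ℕ : (ℕ ⊎ ⊤) ↔ ℕ
ℕ⊎⊤↔ℕ = mk↔ₛ′ [ suc , const zero ] (λ { zero → inj₂ tt ; (suc n) → inj₁ n })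
  (λ { zero → refl ; (suc _) → refl }) (λ { (inj₁ _) → refl ; (inj₂ _) → refl })

ℕ⊎ℕ↔ℕ : (ℕ ⊎ ℕ) ↔ ℕ
ℕ⊎ℕ↔ℕ = mk↔ₛ′ to from to∘from from∘to
  where
  to : ℕ ⊎ ℕ → ℕ
  to (inj₁ zero)    = 0
  to (inj₂ zero)    = 1
  to (inj₁ (suc n)) = 2 + to (inj₁ n)
  to (inj₂ (suc n)) = 2 + to (inj₂ n)

  from : ℕ → ℕ ⊎ ℕ
  from zero          = inj₁ zero
  from (suc zero)    = inj₂ zero
  from (suc (suc n)) = map suc suc (from n)

  to-map-suc : ∀ x → to (map suc suc x) ≡ 2 + to x
  to-map-suc (inj₁ _) = refl
  to-map-suc (inj₂ _) = refl

  to∘from : ∀ n → to (from n) ≡ n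
  to∘from zero          = refl
  to∘from (suc zero)    = refl
  to∘from (suc (suc n)) = trans (to-map-suc (from n)) (cong (2 +_) (to∘from n))

  from∘to : ∀ x → from (to x) ≡ x
  from∘to (inj₁ zero)    = refl
  from∘to (inj₂ zero)    = refl
  from∘to (inj₁ (suc n)) = cong (map suc suc) (from∘to (inj₁ n))
  from∘to (inj₂ (suc n)) = cong (map suc suc) (from∘to (inj₂ n))

^∞-absorbs : ∀ A → (A ^∞ ⊎ˢ single A) ≈ˢ (A ^∞)
^∞-absorbs _ = ℕ⊎⊤↔ℕ , λ { (inj₁ _) → refl ; (inj₂ _) → refl }

^∞-idempotent : ∀ A → (A ^∞ ⊎ˢ A ^∞) ≈ˢ (A ^∞)
^∞-idempotent _ = ℕ⊎ℕ↔ℕ , λ { (inj₁ _) → refl ; (inj₂ _) → refl }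

∞Γ* : List CFml → Seq
∞Γ* []      = ∅
∞Γ* (C ∷ Γ) = (C *) ^∞ ⊎ˢ ∞Γ* Γ

∞Γ*-absorbs : ∀ {C Γ} → C ∈ Γ → (∞Γ* Γ ⊎ˢ single (C *)) ≈ˢ ∞Γ* Γ
∞Γ*-absorbs {Γ = D ∷ Γ} (here refl) = begin
  (D * ^∞ ⊎ˢ ∞Γ* Γ) ⊎ˢ single (D *)  ≈⟨ xy∙z≈xz∙y (D * ^∞) (∞Γ* Γ) (single (D *)) ⟩
  (D * ^∞ ⊎ˢ single (D *)) ⊎ˢ ∞Γ* Γ  ≈⟨ ⊎ˢ-cong (^∞-absorbs (D *)) ≈ˢ-refl ⟩
  D * ^∞ ⊎ˢ ∞Γ* Γ                    ∎
∞Γ*-absorbs {C} {D ∷ Γ} (there C∈Γ) = begin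
  (D * ^∞ ⊎ˢ ∞Γ* Γ) ⊎ˢ single (C *)  ≈⟨ ⊎ˢ-assoc (D * ^∞) (∞Γ* Γ) (single (C *)) ⟩
  D * ^∞ ⊎ˢ (∞Γ* Γ ⊎ˢ single (C *))  ≈⟨ ⊎ˢ-cong ≈ˢ-refl (∞Γ*-absorbs C∈Γ) ⟩
  D * ^∞ ⊎ˢ ∞Γ* Γ                    ∎

∞Γ*-idempotent : ∀ Γ → (∞Γ* Γ ⊎ˢ ∞Γ* Γ) ≈ˢ ∞Γ* Γ
∞Γ*-idempotent []      = ⊎ˢ-identityˡ ∅
∞Γ*-idempotent (C ∷ Γ) = begin
  (C * ^∞ ⊎ˢ ∞Γ* Γ) ⊎ˢ (C * ^∞ ⊎ˢ ∞Γ* Γ)  ≈⟨ interchange (C * ^∞) (∞Γ* Γ) (C * ^∞) (∞Γ* Γ) ⟩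
  (C * ^∞ ⊎ˢ C * ^∞) ⊎ˢ (∞Γ* Γ ⊎ˢ ∞Γ* Γ)  ≈⟨ ⊎ˢ-cong (^∞-idempotent (C *)) (∞Γ*-idempotent Γ) ⟩
  C * ^∞ ⊎ˢ ∞Γ* Γ                          ∎

absorb : ∀ {C Δ} → C ∈ Δ → ALV⊢ (∞Γ* Δ ,, C *) → ALV⊢ ∞Γ* Δ
absorb C∈Δ = exch (∞Γ*-absorbs C∈Δ)

∃∞ˡ : ∀ {Γ A} → ALV⊢ (A ^∞ ⊎ˢ Γ) → ALV⊢ (Γ ,, ∃′ A)
∃∞ˡ {Γ} {A} = ∃∞ ∘ exch (⊎ˢ-comm (A ^∞) Γ)

CL⊢⇒ALV⊢∞Γ* : ∀ {Γ Δ} → CL⊢ Γ → Γ ⊆ Δ → ALV⊢ ∞Γ* Δ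
CL⊢⇒ALV⊢∞Γ* {Δ = Δ} (cl-ax Γ P) Γ⊆Δ =
  absorb (Γ⊆Δ (there (here refl)))
    (exch (⊎ˢ-cong (∞Γ*-absorbs (Γ⊆Δ (here refl))) (≈ˢ-refl {single (neg P)})) (ax (∞Γ* Δ) P))
CL⊢⇒ALV⊢∞Γ* {Δ = Δ} (cl-∧ {Γ} {A} {B} ⊢A ⊢B) Γ⊆Δ =
  absorb (Γ⊆Δ (here refl))
    (exch (⊎ˢ-cong (∞Γ*-idempotent Δ) (≈ˢ-refl {single ((A ∧ B) *)}))
      (⊗-r (∃∞ˡ (CL⊢⇒ALV⊢∞Γ* ⊢A (∷⁺ʳ A tail⊆Δ))) (∃∞ˡ (CL⊢⇒ALV⊢∞Γ* ⊢B (∷⁺ʳ B tail⊆Δ)))))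
  where tail⊆Δ = ⊆-trans (xs⊆x∷xs Γ _) Γ⊆Δ
CL⊢⇒ALV⊢∞Γ* (cl-∨ {Γ} {A} {B} ⊢AB) Γ⊆Δ =
  absorb (Γ⊆Δ (here refl))
    (⅋-r (∃∞ˡ (exch (⊎ˢ-assoc _ _ _) (∃∞ˡ (CL⊢⇒ALV⊢∞Γ* ⊢AB (∷⁺ʳ A (∷⁺ʳ B tail⊆Δ)))))))
  where tail⊆Δ = ⊆-trans (xs⊆x∷xs Γ _) Γ⊆Δ
CL⊢⇒ALV⊢∞Γ* (cl-exch Γ↭Γ′ ⊢Γ) Γ′⊆Δ = CL⊢⇒ALV⊢∞Γ* ⊢Γ (⊆-trans (⊆-reflexive-↭ Γ↭Γ′) Γ′⊆Δ)

∃Γ*-[] : ∅ ≈ˢ ∃Γ* []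
∃Γ*-[] = ↔-sym 0↔⊥ , λ ()

∃Γ*-∷ : ∀ C Γ → (single (∃′ (C *)) ⊎ˢ ∃Γ* Γ) ≈ˢ ∃Γ* (C ∷ Γ)
∃Γ*-∷ _ _ =
  mk↔ₛ′ [ const zero , suc ] (λ { zero → inj₁ tt ; (suc i) → inj₂ i })
    (λ { zero → refl ; (suc _) → refl }) (λ { (inj₁ _) → refl ; (inj₂ _) → refl })
  , λ { (inj₁ _) → refl ; (inj₂ _) → refl }

∞Γ*⇒∃Γ* : ∀ Γ {Θ} → ALV⊢ (Θ ⊎ˢ ∞Γ* Γ) → ALV⊢ (Θ ⊎ˢ ∃Γ* Γ)
∞Γ*⇒∃Γ* [] {Θ} = exch (⊎ˢ-cong (≈ˢ-refl {Θ}) ∃Γ*-[])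
∞Γ*⇒∃Γ* (C ∷ Γ) {Θ} =
  exch (begin
    (Θ ⊎ˢ single (∃′ (C *))) ⊎ˢ ∃Γ* Γ  ≈⟨ ⊎ˢ-assoc Θ (single (∃′ (C *))) (∃Γ* Γ) ⟩
    Θ ⊎ˢ (single (∃′ (C *)) ⊎ˢ ∃Γ* Γ)  ≈⟨ ⊎ˢ-cong ≈ˢ-refl (∃Γ*-∷ C Γ) ⟩
    Θ ⊎ˢ ∃Γ* (C ∷ Γ)                    ∎)
  ∘ ∞Γ*⇒∃Γ* Γ
  ∘ exch (xy∙z≈xz∙y Θ (∞Γ* Γ) _)
  ∘ ∃∞ˡ
  ∘ exch (x∙yz≈y∙xz Θ _ _)

mainTheorem9 : (Γ : List CFml) → CL⊢ Γ → ALV⊢ (∃Γ* Γ)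
mainTheorem9 Γ ⊢Γ =
  exch (⊎ˢ-identityˡ (∃Γ* Γ))
    (∞Γ*⇒∃Γ* Γ (exch (≈ˢ-sym (⊎ˢ-identityˡ (∞Γ* Γ))) (CL⊢⇒ALV⊢∞Γ* ⊢Γ ⊆-refl)))
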